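{- Consider the Learned DFS Ordering (LDFS) algorithm, as described in the context, run on an insertion sequence of $m$ edges whose final graph $G_m$ is acyclic. At any time $t$, if a vertex $v$ has $k$ ancestor edges in $G_t$ on its level (i.e. ancestor edges $(x,y)$ of $v$ in $G_t$ with $\ell(x)=\ell(y)=\ell(v)$ at time $t$), then $\eta\ge k/2$.
   Context: Incremental topological ordering: vertex set $V$, $|V|=n$, initially no edges; directed edges $e_1,\dots,e_m$ arrive one at a time; $G_t$ is the graph after $t$ insertions, $G_m$ the final graph. A vertex $x$ is an ancestor of $y$ if there is a directed path from $x$ to $y$ (every vertex is its own ancestor); if $(x,y)$ is an edge, $x$ is a parent of $y$ and $y$ a child of $x$. An edge $(x,y)$ is an ancestor edge of $w$ (in a given graph) if $y$ is an ancestor of $w$ in that graph. Let $\alpha(v)$ be the number of ancestor edges of $v$ in $G_m$. The algorithm receives predictions $\tilde{\alpha}(v)$; the error is $\eta=\max_{v}|\tilde{\alpha}(v)-\alpha(v)|$. The LDFS algorithm maintains, for each vertex $v$, a level $\ell(v)$ initialized to $\tilde{\alpha}(v)$. On insertion of $(u,v)$: if $\ell(u)>\ell(v)$, set $\ell(v)\leftarrow\ell(u)$ and perform a forward search: for each child $w$ of a vertex $x$ whose level was just raised, if $\ell(x)>\ell(w)$, set $\ell(w)\leftarrow\ell(x)$ and recurse on $w$. No other operation changes levels. (Auxiliary structures for cycle detection and tie-breaking do not affect levels.) -}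

module Defs where

open import Data.Nat using (ℕ; _≤_; _<_; _⊔_; ∣_-_∣)
open import Data.Fin using (Fin; _≟_)
open import Data.Fin.Base using ()
open import Data.List using (List; []; _∷_; _++_; [_]; map; filter; length; foldr; allFin)
open import Data.List.Membership.Propositional using (_∈_)
open import Data.List.Relation.Unary.Unique.Propositional using (Unique)
open import Data.Product using (Σ; _×_; proj₁; proj₂; _,_)
open import Data.Bool using (if_then_else_)
open import Relation.Nullary using (¬_; does)
open import Relation.Binary.PropositionalEquality using (_≡_)

Edge : ℕ → Set
Edge n = Fin n × Fin n

-- A graph is given by its list of edges (in insertion order).
Graph : ℕ → Set
Graph n = List (Edge n)

Levels : ℕ → Set
Levels n = Fin n → ℕ

data Path {n : ℕ} (G : Graph n) : Fin n → Fin n → Set where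
  here  : ∀ {x} → Path G x x
  there : ∀ {x z y} → (x , z) ∈ G → Path G z y → Path G x y

Acyclic : ∀ {n} → Graph n → Set
Acyclic {n} G = ∀ (x y : Fin n) → (x , y) ∈ G → ¬ Path G y x

AncEdge : ∀ {n} → Graph n → Edge n → Fin n → Set
AncEdge G e w = e ∈ G × Path G (proj₂ e) w

-- "exactly k edges satisfy P": a duplicate-free list enumerating exactly the edges with P has length k.
IsCount : ∀ {n} → (Edge n → Set) → ℕ → Set
IsCount {n} P k =
  Σ (List (Edge n)) λ L →
    Unique L × (∀ e → (e ∈ L → P e) × (P e → e ∈ L)) × (length L ≡ k)

children : ∀ {n} → Graph n → Fin n → List (Fin n)
children G x = map proj₂ (filter (λ e → proj₁ e ≟ x) G)

update : ∀ {n} → Levels n → Fin n → ℕ → Levels n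
update ℓ v a w = if does (w ≟ v) then a else ℓ w

-- Forward search: ProcessChildren G ℓ x ws ℓ' means that processing the
-- children ws of the (just-raised) vertex x, starting from levels ℓ,
-- ends with levels ℓ'.
data ProcessChildren {n : ℕ} (G : Graph n) :
       Levels n → Fin n → List (Fin n) → Levels n → Set where
  done  : ∀ {ℓ x} → ProcessChildren G ℓ x [] ℓ
  skip  : ∀ {ℓ x w ws ℓ'} → ℓ w Data.Nat.≥ ℓ x →
          ProcessChildren G ℓ x ws ℓ' → ProcessChildren G ℓ x (w ∷ ws) ℓ'
  raise : ∀ {ℓ x w ws ℓ₁ ℓ'} → ℓ w < ℓ x →
          ProcessChildren G (update ℓ w (ℓ x)) w (children G w) ℓ₁ →
          ProcessChildren G ℓ₁ x ws ℓ' → ProcessChildren G ℓ x (w ∷ ws) ℓ'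

-- Handling the insertion of (u , v); G is the graph after the insertion.
data Insert {n : ℕ} (G : Graph n) (ℓ : Levels n) (u v : Fin n) : Levels n → Set where
  noRaise : ℓ u ≤ ℓ v → Insert G ℓ u v ℓ
  raise   : ∀ {ℓ'} → ℓ v < ℓ u →
            ProcessChildren G (update ℓ v (ℓ u)) v (children G v) ℓ' →
            Insert G ℓ u v ℓ'

-- Run α̃ G ℓ : running LDFS with predictions α̃ on the insertion
-- sequence G (in order) can end with level assignment ℓ.
data Run {n : ℕ} (α̃ : Levels n) : Graph n → Levels n → Set where
  start : Run α̃ [] α̃
  step  : ∀ {G ℓ ℓ' u v} → Run α̃ G ℓ →
          Insert (G ++ [ (u , v) ]) ℓ u v ℓ' → Run α̃ (G ++ [ (u , v) ]) ℓ'

eta : ∀ {n} → Levels n → Levels n → ℕ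
eta {n} α̃ α = foldr _⊔_ 0 (map (λ v → ∣ α̃ v - α v ∣) (allFin n))

-- Every level ℓ v is the prediction α̃ w of some ancestor w of v, since a forward search only copies
-- levels along edges.  Choose such an origin w with α w minimal.  No level edge (x , y) of v can be an
-- ancestor edge of w: the origin w' of ℓ x = ℓ v would be a strictly better choice, as every ancestor
-- edge of w' is one of w, while by acyclicity (x , y) is not one of w'.  So the ancestor edges of w
-- and the k level edges of v are disjoint sets of ancestor edges of v, whence
-- α w + k ≤ α v ≤ α̃ v + η ≤ ℓ v + η = α̃ w + η ≤ α w + 2η.
module Submission where

open import Defs
open import Data.Nat using (ℕ; _≤_; _*_)
open import Data.Fin using (Fin)
open import Data.List using (List; take)
open import Data.List.Relation.Unary.Unique.Propositional using (Unique)
open import Data.Product using (_×_; proj₁; proj₂)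
open import Relation.Binary.PropositionalEquality using (_≡_)

open import Data.Nat using (suc; _+_; _<_; ∣_-_∣; z≤n; s≤s; _≤?_)
open import Data.Nat.Properties
  using (≤-refl; ≤-trans; <⇒≤; +-comm; +-assoc; +-mono-≤; +-monoˡ-≤; +-cancelˡ-≤; +-identityʳ;
         m⊔n≤o⇒m≤o; m⊔n≤o⇒n≤o; m≤n+∣n-m∣; m≤n+∣m-n∣; module ≤-Reasoning)
open import Data.Nat.Induction using (<-wellFounded)
open import Data.Fin using (_≟_)
open import Data.List using ([]; _∷_; [_]; length)
open import Data.List.Properties using (length-++; length-removeAt′; foldr-forcesᵇ)
open import Data.List.Membership.Propositional using (_∈_; _─_)
open import Data.List.Membership.Propositional.Properties
  using (∈-map⁻; ∈-filter⁻; ∈-++⁺ˡ; ∈-++⁺ʳ; ∈-++⁻; ∈-allFin)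
open import Data.List.Relation.Binary.Subset.Propositional using (_⊆_)
open import Data.List.Relation.Binary.Subset.Setoid.Properties using (Sublist⇒Subset)
open import Data.List.Relation.Binary.Sublist.Propositional.Properties using (take-⊆)
open import Data.List.Relation.Unary.Any using (here; there)
import Data.List.Relation.Unary.All as All
open All using ([]; _∷_)
open import Data.List.Relation.Unary.All.Properties using (map⁻)
import Data.List.Relation.Unary.AllPairs as AllPairs
open AllPairs using (_∷_)
import Data.List.Relation.Unary.Unique.Propositional.Properties as Unique
open import Data.Product using (_,_; ∃-syntax)
open import Data.Sum using ([_,_]′)
open import Data.Empty using (⊥; ⊥-elim)
open import Function using (id; _∘_)
open import Induction.WellFounded using (Acc; acc)
open import Relation.Binary.Construct.On using (wellFounded)
open import Relation.Nullary using (¬_; yes; no)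
open import Relation.Nullary.Decidable using (decidable-stable)
open import Relation.Binary.PropositionalEquality using (_≢_; refl; sym; trans; cong; subst; setoid)

module _ {A : Set} where

  ∈-─ : ∀ {x z : A} {ys} (x∈ys : x ∈ ys) → z ∈ ys → z ≢ x → z ∈ ys ─ x∈ys
  ∈-─ (here refl)  (here refl)  z≢x = ⊥-elim (z≢x refl)
  ∈-─ (here refl)  (there z∈ys) _   = z∈ys
  ∈-─ (there _)    (here z≡y)   _   = here z≡y
  ∈-─ (there x∈ys) (there z∈ys) z≢x = there (∈-─ x∈ys z∈ys z≢x)

  Unique-⊆⇒length≤ : ∀ {xs ys : List A} → Unique xs → xs ⊆ ys → length xs ≤ length ys
  Unique-⊆⇒length≤ {[]} _ _ = z≤n
  Unique-⊆⇒length≤ {x ∷ xs} {ys} (x∉xs ∷ uniq) xs⊆ys =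
    subst (suc (length xs) ≤_) (sym (length-removeAt′ ys _))
      (s≤s (Unique-⊆⇒length≤ uniq λ z∈xs →
        ∈-─ x∈ys (xs⊆ys (there z∈xs)) (λ z≡x → All.lookup x∉xs z∈xs (sym z≡x))))
    where x∈ys = xs⊆ys (here refl)

module _ {n : ℕ} {P Q R : Edge n → Set} where

  IsCount-disjoint-+ : ∀ {p q r} → IsCount P p → IsCount Q q → IsCount R r →
    (∀ {e} → P e → Q e → ⊥) → (∀ {e} → P e → R e) → (∀ {e} → Q e → R e) → p + q ≤ r
  IsCount-disjoint-+ (Ps , uPs , Ps↔P , refl) (Qs , uQs , Qs↔Q , refl) (Rs , _ , Rs↔R , refl)
                     disjoint P⇒R Q⇒R =
    subst (_≤ length Rs) (length-++ Ps)
      (Unique-⊆⇒length≤ (Unique.++⁺ uPs uQs (λ (∈Ps , ∈Qs) → disjoint (toP ∈Ps) (toQ ∈Qs)))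
        ([ toR ∘ P⇒R ∘ toP , toR ∘ Q⇒R ∘ toQ ]′ ∘ ∈-++⁻ Ps))
    where
    toP : ∀ {e} → e ∈ Ps → P e
    toP = proj₁ (Ps↔P _)
    toQ : ∀ {e} → e ∈ Qs → Q e
    toQ = proj₁ (Qs↔Q _)
    toR : ∀ {e} → R e → e ∈ Rs
    toR = proj₂ (Rs↔R _)

module _ {n : ℕ} {P R : Edge n → Set} where

  IsCount-⊂⇒< : ∀ {p r} → IsCount P p → IsCount R r → (∀ {e} → P e → R e) →
    ∀ {e} → R e → ¬ P e → p < r
  IsCount-⊂⇒< {p} {r} countP countR P⇒R {e} Re ¬Pe =
    subst (_≤ r) (+-comm p 1)
      (IsCount-disjoint-+ countP singleton countR (λ { Pe refl → ¬Pe Pe }) P⇒R (λ { refl → Re }))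
    where
    singleton : IsCount (_≡ e) 1
    singleton = [ e ] , [] ∷ AllPairs.[] , (λ _ → (λ { (here refl) → refl }) , λ { refl → here refl }) , refl

module _ {n : ℕ} where

  Path-trans : ∀ {G : Graph n} {x y z} → Path G x y → Path G y z → Path G x z
  Path-trans here q = q
  Path-trans (there e p) q = there e (Path-trans p q)

  Path-mono : ∀ {G H : Graph n} → G ⊆ H → ∀ {x y} → Path G x y → Path H x y
  Path-mono G⊆H here = here
  Path-mono G⊆H (there e p) = there (G⊆H e) (Path-mono G⊆H p)

  children⇒edge : ∀ {G : Graph n} {x w} → w ∈ children G x → (x , w) ∈ G
  children⇒edge {G} {x} w∈ with ∈-map⁻ proj₂ w∈
  ... | _ , e∈ , refl with ∈-filter⁻ (λ e → proj₁ e ≟ x) {xs = G} e∈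
  ... | e∈G , refl = e∈G

  AncEdge-trans : ∀ {G : Graph n} {e w w'} → AncEdge G e w → Path G w w' → AncEdge G e w'
  AncEdge-trans (e∈G , y⇝w) w⇝w' = e∈G , Path-trans y⇝w w⇝w'

  AncEdge-mono : ∀ {G H : Graph n} → G ⊆ H → ∀ {e w} → AncEdge G e w → AncEdge H e w
  AncEdge-mono G⊆H (e∈G , y⇝w) = G⊆H e∈G , Path-mono G⊆H y⇝w

  Acyclic⇒¬AncEdge : ∀ {G : Graph n} → Acyclic G → ∀ {x y w} → (x , y) ∈ G →
    Path G w x → ¬ AncEdge G (x , y) w
  Acyclic⇒¬AncEdge acyclic xy∈G w⇝x (_ , y⇝w) = acyclic _ _ xy∈G (Path-trans y⇝w w⇝x)

record Provenance {n : ℕ} (α̃ : Levels n) (G : Graph n) (ℓ : Levels n) : Set where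
  field
    above  : ∀ v → α̃ v ≤ ℓ v
    origin : ∀ v → ∃[ w ] Path G w v × α̃ w ≡ ℓ v

module _ {n : ℕ} {α̃ : Levels n} where

  Provenance-mono : ∀ {G H ℓ} → G ⊆ H → Provenance α̃ G ℓ → Provenance α̃ H ℓ
  Provenance-mono G⊆H prov = record
    { above  = above
    ; origin = λ v → let w , w⇝v , eq = origin v in w , Path-mono G⊆H w⇝v , eq }
    where open Provenance prov

  Provenance-raise : ∀ {G ℓ x w} → Provenance α̃ G ℓ → (x , w) ∈ G → ℓ w < ℓ x →
    Provenance α̃ G (update ℓ w (ℓ x))
  Provenance-raise {G} {ℓ} {x} {w} prov xw∈G ℓw<ℓx = record { above = above′ ; origin = origin′ }
    where
    open Provenance prov
    above′ : ∀ z → α̃ z ≤ update ℓ w (ℓ x) z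
    above′ z with z ≟ w
    ... | yes refl = ≤-trans (above z) (<⇒≤ ℓw<ℓx)
    ... | no _     = above z
    origin′ : ∀ z → ∃[ a ] Path G a z × α̃ a ≡ update ℓ w (ℓ x) z
    origin′ z with z ≟ w
    ... | yes refl = let a , a⇝x , eq = origin x in a , Path-trans a⇝x (there xw∈G here) , eq
    ... | no _     = origin z

  Provenance-processChildren : ∀ {G ℓ x ws ℓ'} → ProcessChildren G ℓ x ws ℓ' →
    (∀ {w} → w ∈ ws → (x , w) ∈ G) → Provenance α̃ G ℓ → Provenance α̃ G ℓ'
  Provenance-processChildren done _ = id
  Provenance-processChildren (skip _ rest) ws⊆ = Provenance-processChildren rest (ws⊆ ∘ there)
  Provenance-processChildren (raise ℓw<ℓx search rest) ws⊆ =
    Provenance-processChildren rest (ws⊆ ∘ there)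
    ∘ Provenance-processChildren search children⇒edge
    ∘ λ prov → Provenance-raise prov (ws⊆ (here refl)) ℓw<ℓx

  Run⇒Provenance : ∀ {G ℓ} → Run α̃ G ℓ → Provenance α̃ G ℓ
  Run⇒Provenance start = record { above = λ _ → ≤-refl ; origin = λ v → v , here , refl }
  Run⇒Provenance (step run (noRaise _)) = Provenance-mono ∈-++⁺ˡ (Run⇒Provenance run)
  Run⇒Provenance (step {G} run (raise ℓv<ℓu search)) =
    Provenance-processChildren search children⇒edge
      (Provenance-raise (Provenance-mono ∈-++⁺ˡ (Run⇒Provenance run)) (∈-++⁺ʳ G (here refl)) ℓv<ℓu)

∣-∣≤eta : ∀ {n} (α̃ α : Levels n) v → ∣ α̃ v - α v ∣ ≤ eta α̃ α
∣-∣≤eta α̃ α v =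
  All.lookup (map⁻ {f = λ w → ∣ α̃ w - α w ∣}
    (foldr-forcesᵇ {P = _≤ eta α̃ α} (λ a b h → m⊔n≤o⇒m≤o a b h , m⊔n≤o⇒n≤o a b h) 0 _ ≤-refl))
    (∈-allFin v)

module LevelEdges {n : ℕ} {α̃ α : Levels n} {es G : Graph n} {ℓ : Levels n}
  (acyclic : Acyclic es) (ancestorEdges : ∀ v → IsCount (λ e → AncEdge es e v) (α v))
  (G⊆es : G ⊆ es) (prov : Provenance α̃ G ℓ) (v : Fin n) where

  open Provenance prov

  η : ℕ
  η = eta α̃ α

  LevelEdge : Edge n → Set
  LevelEdge e = AncEdge G e v × ℓ (proj₁ e) ≡ ℓ v × ℓ (proj₂ e) ≡ ℓ v

  Origin : Fin n → Set
  Origin w = Path G w v × α̃ w ≡ ℓ v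

  levelEdge⇒smallerOrigin : ∀ {w x y} → LevelEdge (x , y) → AncEdge es (x , y) w →
    ∃[ w' ] Origin w' × α w' < α w
  levelEdge⇒smallerOrigin {w} {x} {y} ((xy∈G , y⇝v) , ℓx≡ℓv , _) (xy∈es , y⇝w) =
    w' , (Path-trans w'⇝x (there xy∈G y⇝v) , trans α̃w'≡ℓx ℓx≡ℓv) ,
    IsCount-⊂⇒< (ancestorEdges w') (ancestorEdges w) (λ anc → AncEdge-trans anc w'⇝w)
      (xy∈es , y⇝w) (Acyclic⇒¬AncEdge acyclic xy∈es (Path-mono G⊆es w'⇝x))
    where
    w' : Fin n
    w' = proj₁ (origin x)
    w'⇝x : Path G w' x
    w'⇝x = proj₁ (proj₂ (origin x))
    α̃w'≡ℓx : α̃ w' ≡ ℓ x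
    α̃w'≡ℓx = proj₂ (proj₂ (origin x))
    w'⇝w : Path es w' w
    w'⇝w = Path-trans (Path-mono G⊆es w'⇝x) (there xy∈es y⇝w)

  disjoint⇒α+k≤α : ∀ {k w} → IsCount LevelEdge k → Origin w →
    (∀ {e} → LevelEdge e → ¬ AncEdge es e w) → α w + k ≤ α v
  disjoint⇒α+k≤α {w = w} count (w⇝v , _) disjoint =
    IsCount-disjoint-+ (ancestorEdges w) count (ancestorEdges v) (λ anc level → disjoint level anc)
      (λ anc → AncEdge-trans anc (Path-mono G⊆es w⇝v)) (AncEdge-mono G⊆es ∘ proj₁)

  Origin⇒α≤α+2η : ∀ {w} → Origin w → α v ≤ α w + 2 * η
  Origin⇒α≤α+2η {w} (_ , α̃w≡ℓv) = begin
    α v                          ≤⟨ m≤n+∣n-m∣ (α v) (α̃ v) ⟩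
    α̃ v + ∣ α̃ v - α v ∣         ≤⟨ +-mono-≤ (above v) (∣-∣≤eta α̃ α v) ⟩
    ℓ v + η                      ≡⟨ cong (_+ η) (sym α̃w≡ℓv) ⟩
    α̃ w + η                      ≤⟨ +-monoˡ-≤ η (m≤n+∣m-n∣ (α̃ w) (α w)) ⟩
    α w + ∣ α̃ w - α w ∣ + η      ≤⟨ +-monoˡ-≤ η (+-mono-≤ ≤-refl (∣-∣≤eta α̃ α w)) ⟩
    α w + η + η                  ≡⟨ +-assoc (α w) η η ⟩
    α w + (η + η)                ≡⟨ cong (λ m → α w + (η + m)) (sym (+-identityʳ η)) ⟩
    α w + 2 * η                  ∎
    where open ≤-Reasoning

  -- If k > 2η there is no origin at all, by well-founded induction on α: an origin with no level edge
  -- among its ancestor edges would give k ≤ 2η, and one with such an edge yields a smaller origin.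
  levelEdges≤2η : ∀ {k} → IsCount LevelEdge k → k ≤ 2 * η
  levelEdges≤2η {k} count = decidable-stable (k ≤? 2 * η) λ k≰2η →
    let w , origin-w = origin v in noOrigin k≰2η w (wellFounded α <-wellFounded w) origin-w
    where
    noOrigin : ¬ k ≤ 2 * η → ∀ w → Acc (λ a b → α a < α b) w → ¬ Origin w
    noOrigin k≰2η w (acc smaller) origin-w = k≰2η (+-cancelˡ-≤ (α w) k (2 * η)
      (≤-trans (disjoint⇒α+k≤α count origin-w disjoint) (Origin⇒α≤α+2η origin-w)))
      where
      disjoint : ∀ {e} → LevelEdge e → ¬ AncEdge es e w
      disjoint level anc =
        let w' , origin-w' , αw'<αw = levelEdge⇒smallerOrigin level anc
        in noOrigin k≰2η w' (smaller αw'<αw) origin-w'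

lemma3p4 : ∀ {n} (α̃ α : Levels n) (es : Graph n) →
    Unique es → Acyclic es →
    (∀ v → IsCount (λ e → AncEdge es e v) (α v)) →
    ∀ (t : ℕ) (ℓ : Levels n) → Run α̃ (take t es) ℓ →
    ∀ (v : Fin n) (k : ℕ) →
    IsCount (λ e → AncEdge (take t es) e v × ℓ (proj₁ e) ≡ ℓ v × ℓ (proj₂ e) ≡ ℓ v) k →
    k ≤ 2 * eta α̃ α
lemma3p4 α̃ α es _ acyclic ancestorEdges t ℓ run v k =
  LevelEdges.levelEdges≤2η acyclic ancestorEdges
    (Sublist⇒Subset (setoid _) (take-⊆ t es)) (Run⇒Provenance run) v
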